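{- Let $X',X''$ be a partition of an index set $X$, with sets $X_i$ ($i\in X$), $\Pi := \prod_{i\in X}X_i$, $\Pi' := \prod_{i\in X'}X_i$, $\Pi'' := \prod_{i\in X''}X_i$. Let $\preceq$ be a smooth Hamming relation and $\mu$ the associated choice function. Then $(\mu*3)$ holds: for every $\Sigma\subseteq\Pi$, $\mu(\Pi'\times(\Sigma\upharpoonright X''))\upharpoonright X''\subseteq\mu(\Sigma)\upharpoonright X''$. Consequently, if for $B\subseteq A$ we call $B\subseteq A$ big iff $\mu(A)\subseteq B$, then $(S*3)$ holds: for all $A\subseteq\Sigma\subseteq\Pi$, if $A\subseteq\Sigma$ is big then there is a big $B\subseteq\Pi'\times(\Sigma\upharpoonright X'')$ with $B\upharpoonright X''\subseteq A\upharpoonright X''$.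
   Context: Write $\sigma'=\sigma\upharpoonright X'$, $\sigma''=\sigma\upharpoonright X''$ for $\sigma\in\Pi$, so $\sigma=\sigma'\circ\sigma''$ (concatenation); $\Sigma\upharpoonright X'' = \{\sigma'' : \sigma\in\Sigma\}$. A (generalized) Hamming relation is a reflexive relation $\preceq\subseteq(\Pi\times\Pi)\cup(\Pi'\times\Pi')\cup(\Pi''\times\Pi'')$ such that for all $\sigma,\tau\in\Pi$: $\sigma\preceq\tau$ iff $\sigma'\preceq\tau'$ and $\sigma''\preceq\tau''$. Let $x\prec y$ iff $x\preceq y$ and $x\neq y$. For $A$ a subset of $\Pi$, $\Pi'$ or $\Pi''$, $\mu(A) := \{x\in A : \neg\exists x'\in A\ (x'\prec x)\}$. $\preceq$ is smooth iff for every such $A$ and every $x\in A-\mu(A)$ there is $y\in\mu(A)$ with $y\prec x$. -}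

module Defs where

open import Level using (0ℓ)
open import Data.Sum using (_⊎_; inj₁; inj₂)
open import Data.Product using (Σ; ∃; _×_; _,_; proj₁; proj₂)
open import Relation.Nullary using (¬_)
open import Relation.Unary using (Pred; _⊆_)
open import Relation.Binary using (Rel)
open import Relation.Binary.PropositionalEquality using (_≡_; _≢_)

-- The index set X is the disjoint union X' ⊎ X'' (a partition of X into X', X'');
-- A i is the set X_i.

Π′ : {X′ X″ : Set} → (X′ ⊎ X″ → Set) → Set
Π′ {X′} A = (i : X′) → A (inj₁ i)

Π″ : {X′ X″ : Set} → (X′ ⊎ X″ → Set) → Set
Π″ {X″ = X″} A = (i : X″) → A (inj₂ i)

-- Π = ∏_{i ∈ X} X_i, identified with Π' × Π'' (σ = σ' ∘ σ'').
Π : {X′ X″ : Set} → (X′ ⊎ X″ → Set) → Set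
Π A = Π′ A × Π″ A

restr″ : {X′ X″ : Set} (A : X′ ⊎ X″ → Set) → Pred (Π A) 0ℓ → Pred (Π″ A) 0ℓ
restr″ A S z = ∃ λ (σ : Π A) → S σ × proj₂ σ ≡ z

Π′× : {X′ X″ : Set} (A : X′ ⊎ X″ → Set) → Pred (Π″ A) 0ℓ → Pred (Π A) 0ℓ
Π′× A T σ = T (proj₂ σ)

Strict : {T : Set} → Rel T 0ℓ → Rel T 0ℓ
Strict R x y = R x y × x ≢ y

μ : {T : Set} → Rel T 0ℓ → Pred T 0ℓ → Pred T 0ℓ
μ R S x = S x × ¬ (∃ λ x′ → S x′ × Strict R x′ x)

Smooth : {T : Set} → Rel T 0ℓ → Set₁
Smooth {T} R = (S : Pred T 0ℓ) (x : T) → S x → ¬ μ R S x →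
               ∃ λ y → μ R S y × Strict R y x

-- ≼ given as its three components on Π×Π, Π'×Π', Π''×Π''
record IsHamming {X′ X″ : Set} (A : X′ ⊎ X″ → Set)
                 (R : Rel (Π A) 0ℓ) (R′ : Rel (Π′ A) 0ℓ) (R″ : Rel (Π″ A) 0ℓ) : Set where
  field
    refl  : ∀ σ → R σ σ
    refl′ : ∀ σ → R′ σ σ
    refl″ : ∀ σ → R″ σ σ
    hamming⇒ : ∀ σ τ → R σ τ → R′ (proj₁ σ) (proj₁ τ) × R″ (proj₂ σ) (proj₂ τ)
    hamming⇐ : ∀ σ τ → R′ (proj₁ σ) (proj₁ τ) → R″ (proj₂ σ) (proj₂ τ) → R σ τ

IsBig : {T : Set} → Rel T 0ℓ → Pred T 0ℓ → Pred T 0ℓ → Set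
IsBig R A B = B ⊆ A × μ R A ⊆ B

module Submission where

-- Write σ = (σ′ , σ″) and T = Π′ × (Σ↾X″).
-- (μ*3): let σ ∈ μ(T).  Since σ″ ∈ Σ↾X″ there is τ ∈ Σ with τ″ = σ″, and by
-- smoothness (classically: τ is minimal itself or lies strictly above a
-- minimal element) some ρ ∈ μ(Σ) satisfies ρ ≼ τ, hence ρ″ ≼ τ″ = σ″ by the
-- Hamming property.  As ρ″ ∈ Σ↾X″, the element (σ′ , ρ″) belongs to T and is
-- ≼ σ; minimality of σ in T forces ρ″ = σ″, so σ″ ∈ μ(Σ)↾X″.
-- (S*3) follows from (μ*3) alone: if μ(Σ) ⊆ A, then B := T ∩ (A↾X″ pulled back)
-- contains μ(T), because every minimal element of T has its X″-part in
-- μ(Σ)↾X″ ⊆ A↾X″, and trivially B↾X″ ⊆ A↾X″.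

open import Defs
open import Level using (0ℓ)
open import Data.Sum using (_⊎_)
open import Data.Product using (Σ; ∃; _×_; _,_; proj₁; proj₂)
open import Relation.Unary using (Pred; _⊆_)
open import Relation.Binary using (Rel; Reflexive)
open import Relation.Nullary using (yes; no)
open import Axiom.ExcludedMiddle using (ExcludedMiddle)
open import Axiom.DoubleNegationElimination using (em⇒dne)
open import Relation.Binary.PropositionalEquality using (_≡_; refl; cong; subst)

module _ {X′ X″ : Set} (A : X′ ⊎ X″ → Set) where

  restr″-mono : {S S′ : Pred (Π A) 0ℓ} → S ⊆ S′ → restr″ A S ⊆ restr″ A S′
  restr″-mono S⊆S′ (σ , Sσ , σ″≡z) = σ , S⊆S′ Sσ , σ″≡z

  ⊆Π′×restr″ : (S : Pred (Π A) 0ℓ) → S ⊆ Π′× A (restr″ A S)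
  ⊆Π′×restr″ S {σ} Sσ = σ , Sσ , refl

μ-below : {T : Set} → ExcludedMiddle 0ℓ → (R : Rel T 0ℓ) → Reflexive R →
          Smooth R → (S : Pred T 0ℓ) {x : T} → S x → ∃ λ y → μ R S y × R y x
μ-below em R refl-R smooth S {x} Sx with em {μ R S x}
... | yes μx = x , μx , refl-R
... | no ¬μx with smooth S x Sx ¬μx
...   | y , μy , y≺x = y , μy , proj₁ y≺x

module _ {X′ X″ : Set} (A : X′ ⊎ X″ → Set) (em : ExcludedMiddle 0ℓ)
         {R : Rel (Π A) 0ℓ} {R′ : Rel (Π′ A) 0ℓ} {R″ : Rel (Π″ A) 0ℓ}
         (hamming : IsHamming A R R′ R″) where

  open IsHamming hamming using (refl′; hamming⇒; hamming⇐) renaming (refl to ≼-refl)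

  -- A minimal element σ of Π′ × T admits no element of T strictly below its
  -- X″-part: replacing σ″ by such a z would give a smaller element (σ′ , z).
  μ-Π′×-rigid : (T : Pred (Π″ A) 0ℓ) {σ : Π A} → μ R (Π′× A T) σ →
                {z : Π″ A} → T z → R″ z (proj₂ σ) → z ≡ proj₂ σ
  μ-Π′×-rigid T {σ′ , σ″} (_ , minimal) {z} Tz z≼σ″ = em⇒dne em λ z≢σ″ →
    minimal ((σ′ , z) , Tz , hamming⇐ (σ′ , z) (σ′ , σ″) (refl′ σ′) z≼σ″ ,
             λ eq → z≢σ″ (cong proj₂ eq))

  μ*3 : Smooth R → (S : Pred (Π A) 0ℓ) →
        restr″ A (μ R (Π′× A (restr″ A S))) ⊆ restr″ A (μ R S)
  μ*3 smooth S (σ , μσ@((τ , Sτ , τ″≡σ″) , _) , refl)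
    with μ-below em R (≼-refl _) smooth S Sτ
  ... | ρ , μρ , ρ≼τ = ρ , μρ , ρ″≡σ″
    where
    ρ″≼σ″ : R″ (proj₂ ρ) (proj₂ σ)
    ρ″≼σ″ = subst (R″ (proj₂ ρ)) τ″≡σ″ (proj₂ (hamming⇒ ρ τ ρ≼τ))

    ρ″≡σ″ : proj₂ ρ ≡ proj₂ σ
    ρ″≡σ″ = μ-Π′×-rigid (restr″ A S) μσ (⊆Π′×restr″ A S (proj₁ μρ)) ρ″≼σ″

μ*3⇒S*3 : {X′ X″ : Set} (A : X′ ⊎ X″ → Set) (R : Rel (Π A) 0ℓ)
          (S T : Pred (Π A) 0ℓ) → restr″ A (μ R T) ⊆ restr″ A (μ R S) →
          (Aₛ : Pred (Π A) 0ℓ) → IsBig R S Aₛ →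
          Σ (Pred (Π A) 0ℓ) λ B → IsBig R T B × restr″ A B ⊆ restr″ A Aₛ
μ*3⇒S*3 A R S T μT⊆μS Aₛ (_ , μS⊆Aₛ) =
  B , (proj₁ , μT⊆B) , λ { (_ , (_ , overAₛ) , refl) → overAₛ }
  where
  B : Pred (Π A) 0ℓ
  B σ = T σ × restr″ A Aₛ (proj₂ σ)

  μT⊆B : μ R T ⊆ B
  μT⊆B {σ} μσ = proj₁ μσ , restr″-mono A μS⊆Aₛ (μT⊆μS (σ , μσ , refl))

fact4p10 : {X′ X″ : Set} (A : X′ ⊎ X″ → Set) → ExcludedMiddle 0ℓ →
    (R : Rel (Π A) 0ℓ) (R′ : Rel (Π′ A) 0ℓ) (R″ : Rel (Π″ A) 0ℓ) →
    IsHamming A R R′ R″ → Smooth R → Smooth R′ → Smooth R″ →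
    ((S : Pred (Π A) 0ℓ) →
    restr″ A (μ R (Π′× A (restr″ A S))) ⊆ restr″ A (μ R S))
    ×
    ((S Aₛ : Pred (Π A) 0ℓ) → IsBig R S Aₛ →
    Σ (Pred (Π A) 0ℓ) λ B →
    IsBig R (Π′× A (restr″ A S)) B × restr″ A B ⊆ restr″ A Aₛ)
fact4p10 A em R R′ R″ hamming smooth _ _ = μ*3-holds , S*3-holds
  where
  μ*3-holds : (S : Pred (Π A) 0ℓ) →
              restr″ A (μ R (Π′× A (restr″ A S))) ⊆ restr″ A (μ R S)
  μ*3-holds = μ*3 A em hamming smooth

  S*3-holds : (S Aₛ : Pred (Π A) 0ℓ) → IsBig R S Aₛ →
              Σ (Pred (Π A) 0ℓ) λ B →
                IsBig R (Π′× A (restr″ A S)) B × restr″ A B ⊆ restr″ A Aₛ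
  S*3-holds S = μ*3⇒S*3 A R S (Π′× A (restr″ A S)) (μ*3-holds S)
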